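{- For every $i\ge1$, the following congruences hold modulo $J$: \begin{align*} u_i&\equiv u_id_iu_i, & d_i&\equiv d_iu_id_i,\\ u_iu_{i+1}u_i&\equiv u_{i+1}u_iu_i, & d_id_{i+1}d_i&\equiv d_id_id_{i+1},\\ u_{i+1}u_iu_{i+1}&\equiv u_{i+1}u_{i+1}u_i, & d_{i+1}d_id_{i+1}&\equiv d_id_{i+1}d_{i+1}. \end{align*}
   Context: $\mathcal U$ is the free associative $\mathbf C$-algebra on generators $u_i$ and $d_i$, $i\ge1$, with identity $1$. $J$ is the two-sided ideal of $\mathcal U$ generated by $u_iu_j-u_ju_i$ ($|i-j|\ge2$), $d_id_j-d_jd_i$ ($|i-j|\ge2$), $d_iu_j-u_jd_i$ ($i\ne j$), $d_1u_1-1$, and $d_{i+1}u_{i+1}-u_id_i$ ($i\ge1$). -}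

module Defs where

open import Level using (_⊔_)
open import Data.Nat as ℕ using (ℕ; zero; suc; _≤_)
open import Algebra.Bundles using (CommutativeRing)
open import Relation.Binary.PropositionalEquality using (_≡_)
open import Relation.Nullary using (¬_)

data Far : ℕ → ℕ → Set where
  far< : ∀ {i j} → i ℕ.+ 2 ≤ j → Far i j
  far> : ∀ {i j} → j ℕ.+ 2 ≤ i → Far i j

-- The free associative R-algebra on generators u_i, d_i (i ≥ 1) and its
-- quotient by the two-sided ideal J, presented as a syntax of algebra
-- expressions together with the congruence  x ≡ y (mod J).
-- INDEXING CONVENTION: the constructor  u k  denotes the generator u_{k+1}
-- (similarly d k denotes d_{k+1}), so k ranges over ℕ = {0,1,2,...}.
module Free {c ℓ} (R : CommutativeRing c ℓ) where
  private module R = CommutativeRing R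

  infixl 6 _+_
  infixl 7 _*_

  data Expr : Set c where
    sc  : R.Carrier → Expr
    u   : ℕ → Expr
    d   : ℕ → Expr
    _+_ : Expr → Expr → Expr
    _*_ : Expr → Expr → Expr
    -_  : Expr → Expr

  𝟘 𝟙 : Expr
  𝟘 = sc R.0#
  𝟙 = sc R.1#

  infix 4 _≡J_

  -- Smallest congruence on Expr that makes Expr an associative R-algebra
  -- (this yields the free algebra 𝒰) and contains the generating relations
  -- of J; hence  x ≡J y  iff  x - y ∈ J  in 𝒰.
  data _≡J_ : Expr → Expr → Set (c ⊔ ℓ) where
    refl≡  : ∀ {x} → x ≡J x
    sym≡   : ∀ {x y} → x ≡J y → y ≡J x
    trans≡ : ∀ {x y z} → x ≡J y → y ≡J z → x ≡J z
    +-cong : ∀ {x x′ y y′} → x ≡J x′ → y ≡J y′ → x + y ≡J x′ + y′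
    *-cong : ∀ {x x′ y y′} → x ≡J x′ → y ≡J y′ → x * y ≡J x′ * y′
    neg-cong : ∀ {x y} → x ≡J y → - x ≡J - y
    +-assoc : ∀ x y z → (x + y) + z ≡J x + (y + z)
    +-comm  : ∀ x y → x + y ≡J y + x
    +-idˡ   : ∀ x → 𝟘 + x ≡J x
    +-invˡ  : ∀ x → (- x) + x ≡J 𝟘
    *-assoc : ∀ x y z → (x * y) * z ≡J x * (y * z)
    *-idˡ   : ∀ x → 𝟙 * x ≡J x
    *-idʳ   : ∀ x → x * 𝟙 ≡J x
    distˡ   : ∀ x y z → x * (y + z) ≡J x * y + x * z
    distʳ   : ∀ x y z → (y + z) * x ≡J y * x + z * x
    sc-cong : ∀ {a b} → a R.≈ b → sc a ≡J sc b
    sc-+    : ∀ a b → sc (a R.+ b) ≡J sc a + sc b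
    sc-*    : ∀ a b → sc (a R.* b) ≡J sc a * sc b
    sc-central : ∀ a x → sc a * x ≡J x * sc a
    uu : ∀ {i j} → Far i j → u i * u j ≡J u j * u i
    dd : ∀ {i j} → Far i j → d i * d j ≡J d j * d i
    du : ∀ {i j} → ¬ (i ≡ j) → d i * u j ≡J u j * d i
    d1u1 : d 0 * u 0 ≡J 𝟙
    du-shift : ∀ i → d (suc i) * u (suc i) ≡J u i * d i

-- The heart of the matter is  u_i d_i u_i = u_i,  proved together with
-- d_1 ⋯ d_i u_i ⋯ u_1 = 1 by simultaneous induction on i.  The word
-- d_1 ⋯ d_i is a left inverse of u_i ⋯ u_1 that commutes with u_{i+1} and
-- with d_{i+2} u_{i+2} = u_{i+1} d_{i+1}, so u_{i+1} d_{i+1} u_{i+1} and u_{i+1}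
-- may be compared after right multiplication by u_i ⋯ u_1; there they agree
-- because d_{i+1} u_{i+1} u_i = u_i d_i u_i = u_i.  The cubic relations among
-- the u's follow by the same commutations, and the relations among the d's are
-- their images under the anti-automorphism exchanging u_i and d_i.
module Submission where

open import Defs
open import Data.Nat using (ℕ; suc; _≤_; _<_; s≤s)
open import Data.Nat.Properties as ℕ using (≤-refl; ≤-trans; ≤-reflexive; n≤1+n; <⇒≢; <-≤-trans; 1+n≢n)
open import Relation.Binary.PropositionalEquality using (≢-sym)
open import Data.Product using (_×_; _,_; proj₁; proj₂)
open import Algebra.Bundles using (CommutativeRing; Monoid)
open import Level using (_⊔_)
open import Tactic.MonoidSolver using (solve)

module Commutation {a ℓ} (M : Monoid a ℓ) where
  open Monoid M
  open import Relation.Binary.Reasoning.Setoid setoid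

  Commute : Carrier → Carrier → Set ℓ
  Commute x y = x ∙ y ≈ y ∙ x

  commute-ε : ∀ x → Commute x ε
  commute-ε x = trans (identityʳ x) (sym (identityˡ x))

  commute-∙ʳ : ∀ {x y z} → Commute x y → Commute x z → Commute x (y ∙ z)
  commute-∙ʳ {x} {y} {z} xy xz = begin
    x ∙ (y ∙ z) ≈⟨ assoc x y z ⟨
    x ∙ y ∙ z   ≈⟨ ∙-congʳ xy ⟩
    y ∙ x ∙ z   ≈⟨ assoc y x z ⟩
    y ∙ (x ∙ z) ≈⟨ ∙-congˡ xz ⟩
    y ∙ (z ∙ x) ≈⟨ assoc y z x ⟨
    y ∙ z ∙ x   ∎

  commute-∙ˡ : ∀ {x y z} → Commute x z → Commute y z → Commute (x ∙ y) z
  commute-∙ˡ xz yz = sym (commute-∙ʳ (sym xz) (sym yz))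

  conjugate-by-commuting-inverse : ∀ {a b x} → a ∙ b ≈ ε → Commute x a → a ∙ x ∙ b ≈ x
  conjugate-by-commuting-inverse {a} {b} {x} ab≈ε xa = begin
    a ∙ x ∙ b   ≈⟨ ∙-congʳ xa ⟨
    x ∙ a ∙ b   ≈⟨ assoc x a b ⟩
    x ∙ (a ∙ b) ≈⟨ ∙-congˡ ab≈ε ⟩
    x ∙ ε       ≈⟨ identityʳ x ⟩
    x           ∎

  commuting-left-inverse⇒cancelʳ : ∀ {a b p q} → a ∙ b ≈ ε → Commute p a → Commute q a →
                                   p ∙ b ≈ q ∙ b → p ≈ q
  commuting-left-inverse⇒cancelʳ {a} {b} {p} {q} ab≈ε pa qa pb≈qb = begin
    p           ≈⟨ conjugate-by-commuting-inverse ab≈ε pa ⟨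
    a ∙ p ∙ b   ≈⟨ assoc a p b ⟩
    a ∙ (p ∙ b) ≈⟨ ∙-congˡ pb≈qb ⟩
    a ∙ (q ∙ b) ≈⟨ assoc a q b ⟨
    a ∙ q ∙ b   ≈⟨ conjugate-by-commuting-inverse ab≈ε qa ⟩
    q           ∎

module UpDown {c ℓ} (R : CommutativeRing c ℓ) where
  open Free R
  private module R = CommutativeRing R

  *-monoid : Monoid c (c ⊔ ℓ)
  *-monoid = record
    { Carrier  = Expr
    ; _≈_      = _≡J_
    ; _∙_      = _*_
    ; ε        = 𝟙
    ; isMonoid = record
      { isSemigroup = record
        { isMagma = record
          { isEquivalence = record { refl = refl≡ ; sym = sym≡ ; trans = trans≡ }
          ; ∙-cong        = *-cong
          }
        ; assoc = *-assoc
        }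
      ; identity = *-idˡ , *-idʳ
      }
    }

  open Monoid *-monoid using (setoid; ∙-congˡ; ∙-congʳ)
  open Commutation *-monoid
  open import Relation.Binary.Reasoning.Setoid setoid

  transpose : Expr → Expr
  transpose (sc a)  = sc a
  transpose (u i)   = d i
  transpose (d i)   = u i
  transpose (x + y) = transpose x + transpose y
  transpose (x * y) = transpose y * transpose x
  transpose (- x)   = - transpose x

  transpose-cong : ∀ {x y} → x ≡J y → transpose x ≡J transpose y
  transpose-cong refl≡               = refl≡
  transpose-cong (sym≡ p)            = sym≡ (transpose-cong p)
  transpose-cong (trans≡ p q)        = trans≡ (transpose-cong p) (transpose-cong q)
  transpose-cong (+-cong p q)        = +-cong (transpose-cong p) (transpose-cong q)
  transpose-cong (*-cong p q)        = *-cong (transpose-cong q) (transpose-cong p)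
  transpose-cong (neg-cong p)        = neg-cong (transpose-cong p)
  transpose-cong (+-assoc x y z)     = +-assoc _ _ _
  transpose-cong (+-comm x y)        = +-comm _ _
  transpose-cong (+-idˡ x)           = +-idˡ _
  transpose-cong (+-invˡ x)          = +-invˡ _
  transpose-cong (*-assoc x y z)     = sym≡ (*-assoc _ _ _)
  transpose-cong (*-idˡ x)           = *-idʳ _
  transpose-cong (*-idʳ x)           = *-idˡ _
  transpose-cong (distˡ x y z)       = distʳ _ _ _
  transpose-cong (distʳ x y z)       = distˡ _ _ _
  transpose-cong (sc-cong p)         = sc-cong p
  transpose-cong (sc-+ a b)          = sc-+ a b
  transpose-cong (sc-* a b)          = trans≡ (sc-cong (R.*-comm a b)) (sc-* b a)
  transpose-cong (sc-central a x)    = sym≡ (sc-central a _)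
  transpose-cong (uu (far< p))       = dd (far> p)
  transpose-cong (uu (far> p))       = dd (far< p)
  transpose-cong (dd (far< p))       = uu (far> p)
  transpose-cong (dd (far> p))       = uu (far< p)
  transpose-cong (du i≢j)            = du (≢-sym i≢j)
  transpose-cong d1u1                = d1u1
  transpose-cong (du-shift i)        = du-shift i

  transpose-cong₃ : ∀ {x y z x′ y′ z′} → x * y * z ≡J x′ * y′ * z′ →
                    transpose z * transpose y * transpose x ≡J transpose z′ * transpose y′ * transpose x′
  transpose-cong₃ p = trans≡ (*-assoc _ _ _) (trans≡ (transpose-cong p) (sym≡ (*-assoc _ _ _)))

  -- In the 1-based notation of the header, dWord k = d_1 ⋯ d_k and uWord k = u_k ⋯ u_1.
  dWord uWord : ℕ → Expr
  dWord 0       = 𝟙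
  dWord (suc k) = dWord k * d k
  uWord 0       = 𝟙
  uWord (suc k) = u k * uWord k

  commute-dWord : ∀ {x} k → (∀ {j} → j < k → Commute x (d j)) → Commute x (dWord k)
  commute-dWord {x} 0       _ = commute-ε x
  commute-dWord     (suc k) h = commute-∙ʳ (commute-dWord k (λ j<k → h (ℕ.m<n⇒m<1+n j<k))) (h ≤-refl)

  u-commutes-dWord : ∀ {k n} → k ≤ n → Commute (u n) (dWord k)
  u-commutes-dWord k≤n = commute-dWord _ (λ j<k → sym≡ (du (<⇒≢ (<-≤-trans j<k k≤n))))

  d-commutes-dWord : ∀ {k n} → k < n → Commute (d n) (dWord k)
  d-commutes-dWord k<n = commute-dWord _ (λ {j} j<k →
    dd (far> (≤-trans (≤-reflexive (ℕ.+-comm j 2)) (≤-trans (s≤s j<k) k<n))))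

  d₊u₊u≈u : ∀ {k} → u k * d k * u k ≡J u k → d (suc k) * u (suc k) * u k ≡J u k
  d₊u₊u≈u udu≈u = trans≡ (∙-congʳ (du-shift _)) udu≈u

  dWord*uWord-step : ∀ k → d (suc k) * u (suc k) * u k ≡J u k →
                     dWord (suc k) * uWord (suc k) ≡J 𝟙 → dWord (suc (suc k)) * uWord (suc (suc k)) ≡J 𝟙
  dWord*uWord-step k absorb cancel = begin
    dWord k * d k * d (suc k) * (u (suc k) * (u k * uWord k))  ≈⟨ solve *-monoid ⟩
    dWord k * d k * (d (suc k) * u (suc k) * u k) * uWord k    ≈⟨ ∙-congʳ (∙-congˡ absorb) ⟩
    dWord k * d k * u k * uWord k                              ≈⟨ solve *-monoid ⟩
    dWord k * d k * (u k * uWord k)                            ≈⟨ cancel ⟩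
    𝟙                                                          ∎

  udu≈u-step : ∀ k → d (suc k) * u (suc k) * u k ≡J u k →
               dWord (suc k) * uWord (suc k) ≡J 𝟙 → u (suc k) * d (suc k) * u (suc k) ≡J u (suc k)
  udu≈u-step k absorb cancel = begin
    u m * d m * u m      ≈⟨ ∙-congʳ (du-shift m) ⟨
    d m′ * u m′ * u m    ≈⟨ commuting-left-inverse⇒cancelʳ cancel d′u′u-commutes (u-commutes-dWord ≤-refl) after-uWord ⟩
    u m                  ∎
    where
    m m′ : ℕ
    m  = suc k
    m′ = suc m
    d′u′u-commutes : Commute (d m′ * u m′ * u m) (dWord m)
    d′u′u-commutes = commute-∙ˡ (commute-∙ˡ (d-commutes-dWord ≤-refl) (u-commutes-dWord (n≤1+n m)))
                                (u-commutes-dWord ≤-refl)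
    after-uWord : d m′ * u m′ * u m * uWord m ≡J u m * uWord m
    after-uWord = begin
      d m′ * u m′ * u m * (u k * uWord k)  ≈⟨ ∙-congʳ (∙-congʳ (du-shift m)) ⟩
      u m * d m * u m * (u k * uWord k)    ≈⟨ solve *-monoid ⟩
      u m * (d m * u m * u k) * uWord k    ≈⟨ ∙-congʳ (∙-congˡ absorb) ⟩
      u m * u k * uWord k                  ≈⟨ solve *-monoid ⟩
      u m * (u k * uWord k)                ∎

  udu≈u×dWord*uWord≈𝟙 : ∀ k → (u k * d k * u k ≡J u k) × (dWord (suc k) * uWord (suc k) ≡J 𝟙)
  udu≈u×dWord*uWord≈𝟙 0 = udu≈u₀ , dWord*uWord≈𝟙₁
    where
    udu≈u₀ : u 0 * d 0 * u 0 ≡J u 0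
    udu≈u₀ = begin
      u 0 * d 0 * u 0    ≈⟨ *-assoc _ _ _ ⟩
      u 0 * (d 0 * u 0)  ≈⟨ ∙-congˡ d1u1 ⟩
      u 0 * 𝟙            ≈⟨ *-idʳ _ ⟩
      u 0                ∎
    dWord*uWord≈𝟙₁ : 𝟙 * d 0 * (u 0 * 𝟙) ≡J 𝟙
    dWord*uWord≈𝟙₁ = begin
      𝟙 * d 0 * (u 0 * 𝟙)  ≈⟨ solve *-monoid ⟩
      d 0 * u 0            ≈⟨ d1u1 ⟩
      𝟙                    ∎
  udu≈u×dWord*uWord≈𝟙 (suc k) =
    udu≈u-step k absorb cancel , dWord*uWord-step k absorb cancel
    where
    absorb : d (suc k) * u (suc k) * u k ≡J u k
    absorb = d₊u₊u≈u (proj₁ (udu≈u×dWord*uWord≈𝟙 k))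
    cancel : dWord (suc k) * uWord (suc k) ≡J 𝟙
    cancel = proj₂ (udu≈u×dWord*uWord≈𝟙 k)

  udu≈u : ∀ k → u k * d k * u k ≡J u k
  udu≈u k = proj₁ (udu≈u×dWord*uWord≈𝟙 k)

  dWord*uWord≈𝟙 : ∀ k → dWord k * uWord k ≡J 𝟙
  dWord*uWord≈𝟙 0       = *-idˡ 𝟙
  dWord*uWord≈𝟙 (suc k) = proj₂ (udu≈u×dWord*uWord≈𝟙 k)

  u≈udu : ∀ k → u k ≡J u k * d k * u k
  u≈udu k = sym≡ (udu≈u k)

  d≈dud : ∀ k → d k ≡J d k * u k * d k
  d≈dud k = trans≡ (transpose-cong (u≈udu k)) (sym≡ (*-assoc _ _ _))

  uu′u≈u′uu : ∀ k → u k * u (suc k) * u k ≡J u (suc k) * u k * u k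
  uu′u≈u′uu k = begin
    u k * u m * u k                   ≈⟨ ∙-congˡ absorb ⟨
    u k * u m * (d m * u m * u k)     ≈⟨ solve *-monoid ⟩
    u k * (u m * d m) * (u m * u k)   ≈⟨ ∙-congʳ (∙-congˡ (du-shift m)) ⟨
    u k * (d m′ * u m′) * (u m * u k) ≈⟨ ∙-congʳ shift-commutes ⟨
    d m′ * u m′ * u k * (u m * u k)   ≈⟨ ∙-congʳ (∙-congʳ (du-shift m)) ⟩
    u m * d m * u k * (u m * u k)     ≈⟨ solve *-monoid ⟩
    u m * (d m * u k) * (u m * u k)   ≈⟨ ∙-congʳ (∙-congˡ (du (1+n≢n {k}))) ⟩
    u m * (u k * d m) * (u m * u k)   ≈⟨ solve *-monoid ⟩
    u m * u k * (d m * u m * u k)     ≈⟨ ∙-congˡ absorb ⟩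
    u m * u k * u k                   ∎
    where
    m m′ : ℕ
    m  = suc k
    m′ = suc m
    absorb : d m * u m * u k ≡J u k
    absorb = d₊u₊u≈u (udu≈u k)
    shift-commutes : Commute (d m′ * u m′) (u k)
    shift-commutes = commute-∙ˡ (du λ ()) (uu (far> (≤-reflexive (ℕ.+-comm k 2))))

  u′uu′≈u′u′u : ∀ k → u (suc k) * u k * u (suc k) ≡J u (suc k) * u (suc k) * u k
  u′uu′≈u′u′u k = begin
    u m * u k * u m                                       ≈⟨ ∙-congˡ (conjugate-by-commuting-inverse (dWord*uWord≈𝟙 m) (u-commutes-dWord ≤-refl)) ⟨
    u m * u k * (dWord m * u m * uWord m)                 ≈⟨ solve *-monoid ⟩
    u m * u k * dWord k * (d k * u m * u k) * uWord k     ≈⟨ ∙-congʳ (∙-congʳ u′u-commutes) ⟩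
    dWord k * (u m * u k) * (d k * u m * u k) * uWord k   ≈⟨ solve *-monoid ⟩
    dWord k * (u m * (u k * d k)) * (u m * u k) * uWord k ≈⟨ ∙-congʳ (∙-congʳ (∙-congˡ u′ud≈u′)) ⟩
    dWord k * u m * (u m * u k) * uWord k                 ≈⟨ solve *-monoid ⟩
    dWord k * (u m * u m * u k) * uWord k                 ≈⟨ conjugate-by-commuting-inverse (dWord*uWord≈𝟙 k) u′u′u-commutes ⟩
    u m * u m * u k                                       ∎
    where
    m : ℕ
    m = suc k
    u′ud≈u′ : u m * (u k * d k) ≡J u m
    u′ud≈u′ = trans≡ (∙-congˡ (sym≡ (du-shift k))) (trans≡ (sym≡ (*-assoc _ _ _)) (udu≈u m))
    u′-commutes : Commute (u m) (dWord k)
    u′-commutes = u-commutes-dWord (n≤1+n k)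
    u-commutes : Commute (u k) (dWord k)
    u-commutes = u-commutes-dWord ≤-refl
    u′u-commutes : Commute (u m * u k) (dWord k)
    u′u-commutes = commute-∙ˡ u′-commutes u-commutes
    u′u′u-commutes : Commute (u m * u m * u k) (dWord k)
    u′u′u-commutes = commute-∙ˡ (commute-∙ˡ u′-commutes u′-commutes) u-commutes

  dd′d≈ddd′ : ∀ k → d k * d (suc k) * d k ≡J d k * d k * d (suc k)
  dd′d≈ddd′ k = transpose-cong₃ (uu′u≈u′uu k)

  d′dd′≈dd′d′ : ∀ k → d (suc k) * d k * d (suc k) ≡J d k * d (suc k) * d (suc k)
  d′dd′≈dd′d′ k = transpose-cong₃ (u′uu′≈u′u′u k)

lemma3p6 : ∀ {c ℓ} (R : CommutativeRing c ℓ) → let open Free R in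
    ∀ (k : ℕ) →
      (u k ≡J u k * d k * u k)
      × (d k ≡J d k * u k * d k)
      × (u k * u (suc k) * u k ≡J u (suc k) * u k * u k)
      × (d k * d (suc k) * d k ≡J d k * d k * d (suc k))
      × (u (suc k) * u k * u (suc k) ≡J u (suc k) * u (suc k) * u k)
      × (d (suc k) * d k * d (suc k) ≡J d k * d (suc k) * d (suc k))
lemma3p6 R k = u≈udu k , d≈dud k , uu′u≈u′uu k , dd′d≈ddd′ k , u′uu′≈u′u′u k , d′dd′≈dd′d′ k
  where open UpDown R
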